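{- Let $G$ be a connected graph of order $n \geq 3$ with $\gamma_R(G) = \gamma(G) + 1$. Then $$b_R(G) \leq \min\{b(G), n_\Delta\},$$ where $n_\Delta$ is the number of vertices of maximum degree $\Delta(G)$ in $G$.
   Context: All graphs are finite and simple. A dominating set of $G$ is a set $S \subseteq V(G)$ such that every vertex outside $S$ has a neighbor in $S$; $\gamma(G)$ is the minimum cardinality of a dominating set. The bondage number $b(G)$ is the minimum number of edges whose removal from $G$ yields a graph with larger domination number. A Roman dominating function on $G$ is a function $f: V(G) \to \{0,1,2\}$ such that every vertex $v$ with $f(v)=0$ has a neighbor $u$ with $f(u)=2$; its weight is $\sum_v f(v)$, and $\gamma_R(G)$ is the minimum weight of such a function. For a graph $G$ with maximum degree at least two, the Roman bondage number $b_R(G)$ is the minimum cardinality of a set $E' \subseteq E(G)$ with $\gamma_R(G - E') > \gamma_R(G)$, where $G-E'$ is obtained by deleting the edges of $E'$. -}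

module Defs where

open import Data.Nat using (ℕ; zero; suc; _+_; _≤_; _<_; _⊔_; _⊓_)
open import Data.Bool using (Bool; true; false; _∧_; _∨_; not; if_then_else_)
open import Data.Fin using (Fin; toℕ)
open import Data.Fin.Subset using (Subset; _∈_; ∣_∣)
open import Data.List using (List; map; foldr; allFin)
open import Data.Nat.ListAction using (sum)
open import Data.Bool.Properties using (∨-comm)
open import Relation.Binary.PropositionalEquality using (refl)
open import Data.Product using (Σ; _×_; ∃; ∃-syntax)
open import Data.Sum using (_⊎_)
open import Relation.Binary.PropositionalEquality using (_≡_)
open import Relation.Nullary using (¬_)
open import Relation.Nullary.Decidable using (⌊_⌋)
import Data.Nat as N

record Graph (n : ℕ) : Set where
  field
    adj   : Fin n → Fin n → Bool
    sym   : ∀ u v → adj u v ≡ adj v u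
    irref : ∀ v → adj v v ≡ false
open Graph public

count : {n : ℕ} → (Fin n → Bool) → ℕ
count {n} p = sum (map (λ i → if p i then 1 else 0) (allFin n))

data Reach {n : ℕ} (G : Graph n) : Fin n → Fin n → Set where
  here : ∀ {v} → Reach G v v
  step : ∀ {u w v} → adj G u w ≡ true → Reach G w v → Reach G u v

Connected : {n : ℕ} → Graph n → Set
Connected G = ∀ u v → Reach G u v

deg : {n : ℕ} → Graph n → Fin n → ℕ
deg G v = count (adj G v)

maxDeg : {n : ℕ} → Graph n → ℕ
maxDeg {n} G = foldr _⊔_ 0 (map (deg G) (allFin n))

nΔ : {n : ℕ} → Graph n → ℕ
nΔ G = count (λ v → ⌊ deg G v N.≟ maxDeg G ⌋)

IsMin : (ℕ → Set) → ℕ → Set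
IsMin P k = P k × (∀ m → P m → k ≤ m)

Dominating : {n : ℕ} → Graph n → Subset n → Set
Dominating {n} G S = ∀ v → v ∈ S ⊎ (∃[ u ] (u ∈ S × adj G u v ≡ true))

IsDomNum : {n : ℕ} → Graph n → ℕ → Set
IsDomNum {n} G = IsMin (λ k → Σ (Subset n) λ S → Dominating G S × ∣ S ∣ ≡ k)

RomanDF : {n : ℕ} → Graph n → (Fin n → Fin 3) → Set
RomanDF G f = ∀ v → toℕ (f v) ≡ 0 → ∃[ u ] (adj G u v ≡ true × toℕ (f u) ≡ 2)

weight : {n : ℕ} → (Fin n → Fin 3) → ℕ
weight {n} f = sum (map (λ v → toℕ (f v)) (allFin n))

IsRomanNum : {n : ℕ} → Graph n → ℕ → Set
IsRomanNum {n} G = IsMin (λ k → Σ (Fin n → Fin 3) λ f → RomanDF G f × weight f ≡ k)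

-- Edge sets: F u v = true marks the (unordered) edge {u,v}; F ⊆ E(G).
EdgeSubset : {n : ℕ} → Graph n → (Fin n → Fin n → Bool) → Set
EdgeSubset G F = ∀ u v → F u v ≡ true → adj G u v ≡ true

edgeCount : {n : ℕ} → (Fin n → Fin n → Bool) → ℕ
edgeCount {n} F = sum (map (λ u → count (λ v → ⌊ toℕ u N.<? toℕ v ⌋ ∧ (F u v ∨ F v u))) (allFin n))

removeEdges : {n : ℕ} → (G : Graph n) → (Fin n → Fin n → Bool) → Graph n
removeEdges {n} G F = record { adj = a ; sym = s ; irref = i }
  where
  a : Fin n → Fin n → Bool
  a u v = adj G u v ∧ not (F u v ∨ F v u)
  s : ∀ u v → a u v ≡ a v u
  s u v rewrite Graph.sym G u v | ∨-comm (F u v) (F v u) = refl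
  i : ∀ v → a v v ≡ false
  i v rewrite irref G v = refl

IncreasesDom : {n : ℕ} → Graph n → (Fin n → Fin n → Bool) → Set
IncreasesDom G F = ∀ k k' → IsDomNum G k → IsDomNum (removeEdges G F) k' → k < k'

IncreasesRoman : {n : ℕ} → Graph n → (Fin n → Fin n → Bool) → Set
IncreasesRoman G F = ∀ k k' → IsRomanNum G k → IsRomanNum (removeEdges G F) k' → k < k'

IsBondage : {n : ℕ} → Graph n → ℕ → Set
IsBondage G = IsMin (λ k → Σ _ λ F → EdgeSubset G F × IncreasesDom G F × edgeCount F ≡ k)

IsRomanBondage : {n : ℕ} → Graph n → ℕ → Set
IsRomanBondage G = IsMin (λ k → Σ _ λ F → EdgeSubset G F × IncreasesRoman G F × edgeCount F ≡ k)

-- A connected graph of order n ≥ 3 has a vertex v of degree ≥ 2; labelling v with 2, its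
-- neighbours with 0 and all other vertices with 1 shows γR ≤ n − 1. So a Roman function f of
-- weight ≤ γR = γ + 1 < n must use the label 2, and the vertices labelled 1 or 2 then form a
-- dominating set of size < weight f. Consequently every edge set whose removal raises γ also
-- raises γR, which gives bR ≤ b.
-- For bR ≤ n_Δ, remove one edge at each vertex of maximum degree. If γR did not increase, a Roman
-- function of weight γ + 1 on the smaller graph has γ ≤ |V₁ ∪ V₂|, hence a single vertex v of label
-- 2, adjacent to every vertex of label 0: n ≤ γ + deg' v. Together with γ ≤ n − Δ this forces
-- deg' v = deg v = Δ, although an edge at v was removed.

module Submission where

open import Defs hiding (sym)
open import Data.Nat using (ℕ; zero; suc; _+_; _≤_; _<_; _⊔_; _⊓_; z≤n; s≤s; s≤s⁻¹; _<?_)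
import Data.Nat as ℕ
open import Data.Nat.Properties
  using ( ≤-refl; ≤-reflexive; ≤-trans; ≤-antisym; ≤-<-trans; <⇒≤; <⇒≱; ≰⇒>; ≤∧≢⇒<; n≮n; <-asym
        ; +-comm; +-identityʳ; +-mono-≤; +-monoˡ-≤; +-monoʳ-≤; +-monoʳ-<; +-cancelˡ-≤; m≤m+n; m<m+n
        ; m≤n⇒m≤n⊔o; m≤n⇒m≤o⊔n; ⊔-lub; ⊓-glb; +-0-commutativeMonoid; module ≤-Reasoning )
open import Data.Nat.ListAction using (sum)
open import Data.Bool using (Bool; true; false; not; _∧_; _∨_; if_then_else_)
open import Data.Bool.Properties using () renaming (_≟_ to _≟ᵇ_)
open import Data.Fin using (Fin; zero; suc; toℕ; _≟_)
open import Data.Fin.Properties using (any?; all?; suc-injective)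
open import Data.Fin.Subset using (Subset; _∈_; ∣_∣; ⊤)
open import Data.Fin.Subset.Properties using (_∈?_; anySubset?; ∈⊤)
import Data.Vec as Vec
open import Data.Vec.Properties using (lookup∘tabulate; lookup⇒[]=)
open import Data.List using (map; allFin; tabulate)
open import Data.List.Properties using (map-tabulate; foldr-preservesᵇ; foldr-preservesᵒ)
import Data.List.Relation.Unary.All.Properties as All
import Data.List.Relation.Unary.Any.Properties as Any
open import Data.Product using (Σ; ∃; ∃₂; _×_; _,_; proj₁; proj₂)
open import Data.Sum using (_⊎_; inj₁; inj₂; [_,_])
open import Data.Empty using (⊥; ⊥-elim)
open import Function using (_∘_; id)
open import Relation.Binary.PropositionalEquality
  using (_≡_; _≢_; refl; sym; trans; cong; cong₂; subst; subst₂; module ≡-Reasoning)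
open import Relation.Nullary using (¬_; Dec; yes; no; contradiction)
open import Relation.Nullary.Decidable using (⌊_⌋; _×-dec_; _⊎-dec_; isYes≗does; dec-true)
open import Relation.Unary using (Decidable)
open import Algebra.Properties.CommutativeMonoid.Sum +-0-commutativeMonoid
  using (sum-syntax; ∑-distrib-+; ∑-comm; sum-cong-≗; sum-replicate-zero) renaming (sum to ∑)

sum-map-allFin : {n : ℕ} (f : Fin n → ℕ) → sum (map f (allFin n)) ≡ ∑[ i < n ] f i
sum-map-allFin {n} f = trans (cong sum (map-tabulate (λ i → i) f)) (sum-tabulate f)
  where
  sum-tabulate : {m : ℕ} (g : Fin m → ℕ) → sum (tabulate g) ≡ ∑ g
  sum-tabulate {zero} g = refl
  sum-tabulate {suc m} g = cong (g zero +_) (sum-tabulate (g ∘ suc))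

∑-one : (n : ℕ) → ∑[ i < n ] 1 ≡ n
∑-one zero = refl
∑-one (suc n) = cong suc (∑-one n)

∑-mono-≤ : {n : ℕ} {f g : Fin n → ℕ} → (∀ i → f i ≤ g i) → ∑ f ≤ ∑ g
∑-mono-≤ {zero} f≤g = z≤n
∑-mono-≤ {suc n} f≤g = +-mono-≤ (f≤g zero) (∑-mono-≤ (f≤g ∘ suc))

∑-+-≤ : {n : ℕ} {f g h : Fin n → ℕ} → (∀ i → f i + g i ≤ h i) → ∑ f + ∑ g ≤ ∑ h
∑-+-≤ {f = f} {g} le = subst (_≤ _) (∑-distrib-+ f g) (∑-mono-≤ le)

∑-≤-+ : {n : ℕ} {f g h : Fin n → ℕ} → (∀ i → h i ≤ f i + g i) → ∑ h ≤ ∑ f + ∑ g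
∑-≤-+ {f = f} {g} le = subst (_ ≤_) (∑-distrib-+ f g) (∑-mono-≤ le)

𝟙 : Bool → ℕ
𝟙 b = if b then 1 else 0

count≡∑ : {n : ℕ} (p : Fin n → Bool) → count p ≡ ∑[ i < n ] 𝟙 (p i)
count≡∑ p = sum-map-allFin (𝟙 ∘ p)

count-false : (n : ℕ) → count {n} (λ _ → false) ≡ 0
count-false n = trans (count≡∑ {n} (λ _ → false)) (sum-replicate-zero n)

count-+-≤ : {n : ℕ} {p q r : Fin n → Bool} → (∀ i → 𝟙 (p i) + 𝟙 (q i) ≤ 𝟙 (r i)) →
            count p + count q ≤ count r
count-+-≤ {p = p} {q} {r} le =
  subst₂ _≤_ (sym (cong₂ _+_ (count≡∑ p) (count≡∑ q))) (sym (count≡∑ r)) (∑-+-≤ le)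

count-partition : {n : ℕ} {p q : Fin n → Bool} → (∀ i → 𝟙 (p i) + 𝟙 (q i) ≡ 1) →
                  count p + count q ≡ n
count-partition {n} {p} {q} eq = begin
  count p + count q                    ≡⟨ cong₂ _+_ (count≡∑ p) (count≡∑ q) ⟩
  ∑[ i < n ] 𝟙 (p i) + ∑[ i < n ] 𝟙 (q i) ≡⟨ ∑-distrib-+ (𝟙 ∘ p) (𝟙 ∘ q) ⟨
  ∑[ i < n ] (𝟙 (p i) + 𝟙 (q i))        ≡⟨ sum-cong-≗ eq ⟩
  ∑[ i < n ] 1                          ≡⟨ ∑-one n ⟩
  n                                     ∎
  where open ≡-Reasoning

count-mono : {n : ℕ} {p q : Fin n → Bool} → (∀ i → p i ≡ true → q i ≡ true) → count p ≤ count q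
count-mono {p = p} {q} p⊆q =
  subst₂ _≤_ (sym (count≡∑ p)) (sym (count≡∑ q)) (∑-mono-≤ 𝟙-mono)
  where
  𝟙-mono : ∀ i → 𝟙 (p i) ≤ 𝟙 (q i)
  𝟙-mono i with p i | p⊆q i
  ... | true  | pi⇒qi rewrite pi⇒qi refl = ≤-refl
  ... | false | _ = z≤n

count-singleton : {n : ℕ} (j : Fin n) → count (λ i → ⌊ i ≟ j ⌋) ≡ 1
count-singleton j = trans (count≡∑ (λ i → ⌊ i ≟ j ⌋)) (∑-singleton j)
  where
  ∑-singleton : {n : ℕ} (j : Fin n) → ∑[ i < n ] 𝟙 ⌊ i ≟ j ⌋ ≡ 1
  ∑-singleton {suc n} zero = cong suc (sum-replicate-zero n)
  ∑-singleton {suc n} (suc j) = trans (sum-cong-≗ {n} (cong 𝟙 ∘ suc-≟-suc)) (∑-singleton j)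
    where
    suc-≟-suc : ∀ i → ⌊ suc i ≟ suc j ⌋ ≡ ⌊ i ≟ j ⌋
    suc-≟-suc i with i ≟ j
    ... | yes refl = refl
    ... | no i≢j with suc i ≟ suc j
    ...   | yes si≡sj = contradiction (suc-injective si≡sj) i≢j
    ...   | no _ = refl

count-pos : {n : ℕ} {p : Fin n → Bool} (j : Fin n) → p j ≡ true → 1 ≤ count p
count-pos {p = p} j pj = subst (_≤ count p) (count-singleton j) (count-mono j⇒p)
  where
  j⇒p : ∀ i → ⌊ i ≟ j ⌋ ≡ true → p i ≡ true
  j⇒p i i≟j with i ≟ j
  ... | yes refl = pj

count-witness : {n : ℕ} (p : Fin n → Bool) → 1 ≤ count p → ∃ λ j → p j ≡ true
count-witness {n} p 1≤c with any? (λ j → p j ≟ᵇ true)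
... | yes w = w
... | no ∄ = contradiction (≤-trans 1≤c (≤-trans (count-mono p⊆∅) (≤-reflexive (count-false n)))) λ ()
  where
  p⊆∅ : ∀ i → p i ≡ true → false ≡ true
  p⊆∅ i pi = ⊥-elim (∄ (i , pi))

count-strict : {n : ℕ} {p q : Fin n → Bool} (j : Fin n) → (∀ i → p i ≡ true → q i ≡ true) →
               q j ≡ true → p j ≡ false → count p < count q
count-strict {p = p} {q} j p⊆q qj pj =
  subst (_≤ count q) (trans (cong (count p +_) (count-singleton j)) (+-comm (count p) 1))
    (count-+-≤ pointwise)
  where
  pointwise : ∀ i → 𝟙 (p i) + 𝟙 ⌊ i ≟ j ⌋ ≤ 𝟙 (q i)
  pointwise i with i ≟ j
  ... | yes refl rewrite pj | qj = ≤-refl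
  ... | no _ with p i | p⊆q i
  ...   | true  | pi⇒qi rewrite pi⇒qi refl = ≤-refl
  ...   | false | _ = z≤n

count-two : {n : ℕ} {p : Fin n → Bool} {u v : Fin n} → u ≢ v → p u ≡ true → p v ≡ true → 2 ≤ count p
count-two {p = p} {u} {v} u≢v pu pv =
  subst₂ (λ a b → a + b ≤ count p) (count-singleton u) (count-singleton v) (count-+-≤ pointwise)
  where
  pointwise : ∀ i → 𝟙 ⌊ i ≟ u ⌋ + 𝟙 ⌊ i ≟ v ⌋ ≤ 𝟙 (p i)
  pointwise i with i ≟ u | i ≟ v
  ... | yes refl | yes refl = contradiction refl u≢v
  ... | yes refl | no _ rewrite pu = ≤-refl
  ... | no _ | yes refl rewrite pv = ≤-refl
  ... | no _ | no _ = z≤n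

count≤1⇒unique : {n : ℕ} {p : Fin n → Bool} {u v : Fin n} → count p ≤ 1 →
                 p u ≡ true → p v ≡ true → u ≡ v
count≤1⇒unique {u = u} {v} c≤1 pu pv with u ≟ v
... | yes u≡v = u≡v
... | no u≢v = contradiction (≤-trans (count-two u≢v pu pv) c≤1) λ { (s≤s ()) }

toSubset : {n : ℕ} → (Fin n → Bool) → Subset n
toSubset = Vec.tabulate

∈-toSubset : {n : ℕ} {p : Fin n → Bool} {x : Fin n} → p x ≡ true → x ∈ toSubset p
∈-toSubset {p = p} {x} px = lookup⇒[]= x (toSubset p) (trans (lookup∘tabulate p x) px)

∣toSubset∣ : {n : ℕ} (p : Fin n → Bool) → ∣ toSubset p ∣ ≡ count p
∣toSubset∣ p = trans (∣tabulate∣ p) (sym (count≡∑ p))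
  where
  ∣tabulate∣ : {n : ℕ} (p : Fin n → Bool) → ∣ toSubset p ∣ ≡ ∑[ i < n ] 𝟙 (p i)
  ∣tabulate∣ {zero} p = refl
  ∣tabulate∣ {suc n} p with p zero
  ... | true  = cong suc (∣tabulate∣ (p ∘ suc))
  ... | false = ∣tabulate∣ (p ∘ suc)

IsMin-unique : {P : ℕ → Set} {k k′ : ℕ} → IsMin P k → IsMin P k′ → k ≡ k′
IsMin-unique (pk , k-min) (pk′ , k′-min) = ≤-antisym (k-min _ pk′) (k′-min _ pk)

IsMin-exists : {P : ℕ → Set} → Decidable P → {m : ℕ} → P m → ∃ (IsMin P)
IsMin-exists {P} P? {m} pm = [ id , (λ m< → contradiction (m< m pm) (n≮n m)) ] (search (suc m))
  where
  search : ∀ m → ∃ (IsMin P) ⊎ (∀ k → P k → m ≤ k)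
  search zero = inj₂ λ _ _ → z≤n
  search (suc m) with search m
  ... | inj₁ found = inj₁ found
  ... | inj₂ m≤ with P? m
  ...   | yes pm = inj₁ (m , pm , m≤)
  ...   | no ¬pm = inj₂ λ k pk → ≤∧≢⇒< (m≤ k pk) λ m≡k → ¬pm (subst P (sym m≡k) pk)

dominating? : {n : ℕ} (G : Graph n) → Decidable (Dominating G)
dominating? G S = all? λ v → v ∈? S ⊎-dec any? λ u → u ∈? S ×-dec adj G u v ≟ᵇ true

domNum-exists : {n : ℕ} (G : Graph n) → ∃ (IsDomNum G)
domNum-exists {n} G = IsMin-exists (λ k → anySubset? λ S → dominating? G S ×-dec ∣ S ∣ ℕ.≟ k)
                                   (⊤ , (λ _ → inj₁ ∈⊤) , refl)

crossing-edge : {n : ℕ} {G : Graph n} {P : Fin n → Set} → Decidable P → {x y : Fin n} →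
                Reach G x y → ¬ P x → P y → ∃₂ λ u w → ¬ P u × P w × adj G u w ≡ true
crossing-edge P? here ¬px py = contradiction py ¬px
crossing-edge P? {x} (step {w = w} xw wy) ¬px py with P? w
... | yes pw = x , w , ¬px , pw , xw
... | no ¬pw = crossing-edge P? wy ¬pw py

-- Take an edge 0w and a third vertex; where a path from the third vertex first enters {0, w},
-- the vertex entered has a second neighbour.
connected⇒2≤deg : {n : ℕ} → 3 ≤ n → (G : Graph n) → Connected G → ∃ λ v → 2 ≤ deg G v
connected⇒2≤deg {suc (suc (suc _))} (s≤s (s≤s (s≤s _))) G conn with conn zero (suc zero)
... | step {w = w} 0w _ with crossing-edge {P = λ x → x ≡ zero ⊎ x ≡ w} (λ x → x ≟ zero ⊎-dec x ≟ w)
                                           (conn third zero) third∉ (inj₁ refl)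
  where
  third : Fin _
  third with w ≟ suc zero
  ... | yes _ = suc (suc zero)
  ... | no _  = suc zero
  third∉ : ¬ (third ≡ zero ⊎ third ≡ w)
  third∉ with w ≟ suc zero
  ... | yes refl = [ (λ ()) , (λ ()) ]
  ... | no w≢1   = [ (λ ()) , w≢1 ∘ sym ]
... | u , _ , u∉ , inj₁ refl , u0 =
  zero , count-two {p = adj G zero} (u∉ ∘ inj₂ ∘ sym) 0w (trans (Graph.sym G zero u) u0)
... | u , _ , u∉ , inj₂ refl , uw =
  w , count-two {p = adj G w} (u∉ ∘ inj₁ ∘ sym) (trans (Graph.sym G w zero) 0w)
                                                 (trans (Graph.sym G w u) uw)

deg≤maxDeg : {n : ℕ} (G : Graph n) (v : Fin n) → deg G v ≤ maxDeg G
deg≤maxDeg G v =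
  foldr-preservesᵒ {P = deg G v ≤_} {f = _⊔_} (λ x y → [ m≤n⇒m≤n⊔o y , m≤n⇒m≤o⊔n x ]) 0 _
                   (inj₂ (Any.map⁺ (Any.tabulate⁺ v ≤-refl)))

maxDeg-lub : {n : ℕ} (G : Graph n) {m : ℕ} → (∀ v → deg G v ≤ m) → maxDeg G ≤ m
maxDeg-lub G {m} deg≤m =
  foldr-preservesᵇ {P = _≤ m} {f = _⊔_} ⊔-lub z≤n (All.map⁺ (All.tabulate⁺ deg≤m))

-- The vertices outside N(w) form a dominating set: w is among them and dominates N(w).
deg+γ≤n : {n : ℕ} (G : Graph n) {γ : ℕ} → IsDomNum G γ → (w : Fin n) → deg G w + γ ≤ n
deg+γ≤n {n} G {γ} (_ , γ-min) w = begin
  deg G w + γ                          ≤⟨ +-monoʳ-≤ (deg G w) (γ-min _ (S , S-dom , ∣toSubset∣ nonNbr)) ⟩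
  deg G w + count nonNbr               ≡⟨ +-comm (deg G w) _ ⟩
  count nonNbr + count (adj G w)       ≡⟨ count-partition (λ x → 𝟙-not (adj G w x)) ⟩
  n                                    ∎
  where
  open ≤-Reasoning
  nonNbr : Fin n → Bool
  nonNbr = not ∘ adj G w
  S : Subset n
  S = toSubset nonNbr
  S-dom : Dominating G S
  S-dom x with adj G w x in wx
  ... | true  = inj₂ (w , ∈-toSubset (cong not (irref G w)) , wx)
  ... | false = inj₁ (∈-toSubset (cong not wx))
  𝟙-not : ∀ b → 𝟙 (not b) + 𝟙 b ≡ 1
  𝟙-not true  = refl
  𝟙-not false = refl

module _ {n : ℕ} (G : Graph n) (F : Fin n → Fin n → Bool) where

  adj-removeEdges : {u v : Fin n} → adj (removeEdges G F) u v ≡ true → adj G u v ≡ true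
  adj-removeEdges {u} {v} uv with adj G u v
  ... | true = refl

  dominating-removeEdges : {S : Subset n} → Dominating (removeEdges G F) S → Dominating G S
  dominating-removeEdges S-dom x with S-dom x
  ... | inj₁ x∈S = inj₁ x∈S
  ... | inj₂ (u , u∈S , ux) = inj₂ (u , u∈S , adj-removeEdges ux)

  deg-removeEdges≤ : (v : Fin n) → deg (removeEdges G F) v ≤ deg G v
  deg-removeEdges≤ v = count-mono {p = adj (removeEdges G F) v} λ _ → adj-removeEdges

  deg-removeEdges< : {v w : Fin n} → F v w ≡ true → adj G v w ≡ true → deg (removeEdges G F) v < deg G v
  deg-removeEdges< {v} {w} vw∈F vw =
    count-strict {p = adj (removeEdges G F) v} w (λ _ → adj-removeEdges) vw removed
    where
    removed : adj (removeEdges G F) v w ≡ false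
    removed rewrite vw | vw∈F = refl

isZero isTwo : Fin 3 → Bool
isZero zero = true
isZero _    = false
isTwo (suc (suc zero)) = true
isTwo _                = false

module _ {n : ℕ} (f : Fin n → Fin 3) where

  V₀ V₂ V₁₂ : Fin n → Bool
  V₀  = isZero ∘ f
  V₂  = isTwo ∘ f
  V₁₂ = not ∘ V₀

  weight≡V₁₂+V₂ : weight f ≡ count V₁₂ + count V₂
  weight≡V₁₂+V₂ = begin
    weight f                                  ≡⟨ sum-map-allFin (toℕ ∘ f) ⟩
    ∑[ x < n ] toℕ (f x)                       ≡⟨ sum-cong-≗ (toℕ-split ∘ f) ⟩
    ∑[ x < n ] (𝟙 (V₁₂ x) + 𝟙 (V₂ x))          ≡⟨ ∑-distrib-+ (𝟙 ∘ V₁₂) (𝟙 ∘ V₂) ⟩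
    ∑[ x < n ] 𝟙 (V₁₂ x) + ∑[ x < n ] 𝟙 (V₂ x) ≡⟨ cong₂ _+_ (count≡∑ V₁₂) (count≡∑ V₂) ⟨
    count V₁₂ + count V₂                      ∎
    where
    open ≡-Reasoning
    toℕ-split : ∀ y → toℕ y ≡ 𝟙 (not (isZero y)) + 𝟙 (isTwo y)
    toℕ-split zero             = refl
    toℕ-split (suc zero)       = refl
    toℕ-split (suc (suc zero)) = refl

  V₁₂+V₀≡n : count V₁₂ + count V₀ ≡ n
  V₁₂+V₀≡n = count-partition (𝟙-split ∘ f)
    where
    𝟙-split : ∀ y → 𝟙 (not (isZero y)) + 𝟙 (isZero y) ≡ 1
    𝟙-split zero    = refl
    𝟙-split (suc _) = refl

  V₂⊆V₁₂ : ∀ {x} → V₂ x ≡ true → V₁₂ x ≡ true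
  V₂⊆V₁₂ {x} x∈V₂ with f x
  ... | suc (suc zero) = refl

  module _ {H : Graph n} (rdf : RomanDF H f) where

    V₀-has-V₂-neighbour : ∀ {x} → V₀ x ≡ true → ∃ λ u → adj H u x ≡ true × V₂ u ≡ true
    V₀-has-V₂-neighbour {x} x∈V₀ with f x | rdf x
    ... | zero | dominated with dominated refl
    ...   | u , ux , fu≡2 = u , ux , toℕ≡2⇒isTwo (f u) fu≡2
      where
      toℕ≡2⇒isTwo : ∀ y → toℕ y ≡ 2 → isTwo y ≡ true
      toℕ≡2⇒isTwo (suc (suc zero)) _ = refl

    V₁₂-dominating : Dominating H (toSubset V₁₂)
    V₁₂-dominating x with V₀ x in x∈V₀
    ... | false = inj₁ (∈-toSubset (cong not x∈V₀))
    ... | true with V₀-has-V₂-neighbour x∈V₀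
    ...   | u , ux , u∈V₂ = inj₂ (u , ∈-toSubset (V₂⊆V₁₂ u∈V₂) , ux)

    V₂-nonempty : weight f < n → ∃ λ v → V₂ v ≡ true
    V₂-nonempty w<n with any? (λ v → V₂ v ≟ᵇ true)
    ... | yes v∈V₂ = v∈V₂
    ... | no V₂≡∅ = contradiction n≤weight (<⇒≱ w<n)
      where
      V₀⊆V₂ : ∀ x → V₀ x ≡ true → V₂ x ≡ true
      V₀⊆V₂ x x∈V₀ with V₀-has-V₂-neighbour x∈V₀
      ... | u , _ , u∈V₂ = contradiction (u , u∈V₂) V₂≡∅
      n≤weight : n ≤ weight f
      n≤weight = subst₂ _≤_ V₁₂+V₀≡n (sym weight≡V₁₂+V₂)
                   (+-monoʳ-≤ (count V₁₂) (count-mono V₀⊆V₂))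

    romanDF⇒dominating< : weight f < n → Σ (Subset n) λ S → Dominating H S × ∣ S ∣ < weight f
    romanDF⇒dominating< w<n with V₂-nonempty w<n
    ... | v , v∈V₂ = toSubset V₁₂ , V₁₂-dominating ,
                     subst₂ _<_ (sym (∣toSubset∣ V₁₂)) (sym weight≡V₁₂+V₂)
                            (m<m+n (count V₁₂) (count-pos v v∈V₂))

    -- With a single vertex v of label 2, every vertex of label 0 must be a neighbour of v.
    n≤V₁₂+deg : ∀ {v} → V₂ v ≡ true → count V₂ ≤ 1 → n ≤ count V₁₂ + deg H v
    n≤V₁₂+deg {v} v∈V₂ V₂≤1 =
      subst (_≤ count V₁₂ + deg H v) V₁₂+V₀≡n (+-monoʳ-≤ (count V₁₂) (count-mono V₀⊆N[v]))
      where
      V₀⊆N[v] : ∀ x → V₀ x ≡ true → adj H v x ≡ true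
      V₀⊆N[v] x x∈V₀ with V₀-has-V₂-neighbour x∈V₀
      ... | u , ux , u∈V₂ = subst (λ w → adj H w x ≡ true) (count≤1⇒unique V₂≤1 u∈V₂ v∈V₂) ux

    light⇒n≤γ+deg : ∀ {γ} → γ ≤ count V₁₂ → weight f ≤ suc γ → suc γ < n → ∃ λ v → n ≤ γ + deg H v
    light⇒n≤γ+deg {γ} γ≤V₁₂ w≤γR γR<n with V₂-nonempty (≤-<-trans w≤γR γR<n)
    ... | v , v∈V₂ = v , ≤-trans (n≤V₁₂+deg v∈V₂ V₂≤1) (+-monoˡ-≤ (deg H v) V₁₂≤γ)
      where
      V₁₂+V₂≤γR : count V₁₂ + count V₂ ≤ suc γ
      V₁₂+V₂≤γR = subst (_≤ suc γ) weight≡V₁₂+V₂ w≤γR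
      V₂≤1 : count V₂ ≤ 1
      V₂≤1 = +-cancelˡ-≤ (count V₁₂) _ _
               (≤-trans V₁₂+V₂≤γR (subst (suc γ ≤_) (+-comm 1 (count V₁₂)) (s≤s γ≤V₁₂)))
      V₁₂≤γ : count V₁₂ ≤ γ
      V₁₂≤γ = s≤s⁻¹ (≤-trans (m<m+n (count V₁₂) (count-pos v v∈V₂)) V₁₂+V₂≤γR)

module _ {n : ℕ} (G : Graph n) (v : Fin n) where

  star : Fin n → Fin 3
  star x = if ⌊ x ≟ v ⌋ then suc (suc zero) else if adj G v x then zero else suc zero

  star-romanDF : RomanDF G star
  star-romanDF x _ with x ≟ v | adj G v x in vx
  star-romanDF x () | yes _ | _
  star-romanDF x _  | no _  | true = v , vx , centre
    where
    centre : toℕ (star v) ≡ 2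
    centre with v ≟ v
    ... | yes _  = refl
    ... | no v≢v = contradiction refl v≢v
  star-romanDF x () | no _  | false

  weight-star : weight star + deg G v ≡ suc n
  weight-star = begin
    weight star + deg G v
      ≡⟨ cong₂ _+_ (sum-map-allFin (toℕ ∘ star)) (count≡∑ (adj G v)) ⟩
    ∑[ x < n ] toℕ (star x) + ∑[ x < n ] 𝟙 (adj G v x)
      ≡⟨ ∑-distrib-+ (toℕ ∘ star) (𝟙 ∘ adj G v) ⟨
    ∑[ x < n ] (toℕ (star x) + 𝟙 (adj G v x))
      ≡⟨ sum-cong-≗ pointwise ⟩
    ∑[ x < n ] (1 + 𝟙 ⌊ x ≟ v ⌋)
      ≡⟨ ∑-distrib-+ (λ _ → 1) (λ x → 𝟙 ⌊ x ≟ v ⌋) ⟩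
    ∑[ x < n ] 1 + ∑[ x < n ] 𝟙 ⌊ x ≟ v ⌋
      ≡⟨ cong₂ _+_ (∑-one n) (trans (sym (count≡∑ (λ x → ⌊ x ≟ v ⌋))) (count-singleton v)) ⟩
    n + 1
      ≡⟨ +-comm n 1 ⟩
    suc n
      ∎
    where
    open ≡-Reasoning
    pointwise : ∀ x → toℕ (star x) + 𝟙 (adj G v x) ≡ 1 + 𝟙 ⌊ x ≟ v ⌋
    pointwise x with x ≟ v
    ... | yes refl rewrite irref G x = refl
    ... | no _ with adj G v x
    ...   | true  = refl
    ...   | false = refl

romanNum+deg≤ : {n : ℕ} (G : Graph n) {γR : ℕ} → IsRomanNum G γR → (v : Fin n) → γR + deg G v ≤ suc n
romanNum+deg≤ G (_ , γR-min) v =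
  ≤-trans (+-monoˡ-≤ (deg G v) (γR-min _ (star G v , star-romanDF G v , refl)))
          (≤-reflexive (weight-star G v))

romanNum<order : {n : ℕ} → 3 ≤ n → (G : Graph n) → Connected G → {γR : ℕ} → IsRomanNum G γR → γR < n
romanNum<order {n} 3≤n G conn {γR} rom with connected⇒2≤deg 3≤n G conn
... | v , 2≤deg =
  s≤s⁻¹ (subst (_≤ suc n) (+-comm γR 2) (≤-trans (+-monoʳ-≤ γR 2≤deg) (romanNum+deg≤ G rom v)))

-- Each edge {u, v} with u < v is charged to the ordered pair that F marks.
edgeCount≤∑count : {n : ℕ} (F : Fin n → Fin n → Bool) → edgeCount F ≤ ∑[ u < n ] count (F u)
edgeCount≤∑count {n} F = begin
  edgeCount F
    ≡⟨ trans (sum-map-allFin (count ∘ marked)) (sum-cong-≗ (count≡∑ ∘ marked)) ⟩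
  ∑[ u < n ] ∑[ v < n ] 𝟙 (lt u v ∧ (F u v ∨ F v u))
    ≤⟨ ∑-mono-≤ (λ u → ∑-≤-+ (λ v → split (lt u v) (F u v) (F v u))) ⟩
  ∑[ u < n ] (∑[ v < n ] 𝟙 (lt u v ∧ F u v) + ∑[ v < n ] 𝟙 (lt u v ∧ F v u))
    ≡⟨ ∑-distrib-+ (λ u → ∑[ v < n ] 𝟙 (lt u v ∧ F u v)) (λ u → ∑[ v < n ] 𝟙 (lt u v ∧ F v u)) ⟩
  ∑[ u < n ] ∑[ v < n ] 𝟙 (lt u v ∧ F u v) + ∑[ u < n ] ∑[ v < n ] 𝟙 (lt u v ∧ F v u)
    ≡⟨ cong (∑[ u < n ] ∑[ v < n ] 𝟙 (lt u v ∧ F u v) +_) (∑-comm (λ u v → 𝟙 (lt u v ∧ F v u))) ⟩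
  ∑[ u < n ] ∑[ v < n ] 𝟙 (lt u v ∧ F u v) + ∑[ u < n ] ∑[ v < n ] 𝟙 (lt v u ∧ F u v)
    ≤⟨ ∑-+-≤ (λ u → ∑-+-≤ (λ v → merge u v)) ⟩
  ∑[ u < n ] ∑[ v < n ] 𝟙 (F u v)
    ≡⟨ sum-cong-≗ (λ u → count≡∑ (F u)) ⟨
  ∑[ u < n ] count (F u)
    ∎
  where
  open ≤-Reasoning
  lt : Fin n → Fin n → Bool
  lt u v = ⌊ toℕ u <? toℕ v ⌋
  marked : Fin n → Fin n → Bool
  marked u v = lt u v ∧ (F u v ∨ F v u)
  split : ∀ l a b → 𝟙 (l ∧ (a ∨ b)) ≤ 𝟙 (l ∧ a) + 𝟙 (l ∧ b)
  split false _     _ = z≤n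
  split true  true  b = m≤m+n 1 (𝟙 b)
  split true  false b = ≤-refl
  merge : ∀ u v → 𝟙 (lt u v ∧ F u v) + 𝟙 (lt v u ∧ F u v) ≤ 𝟙 (F u v)
  merge u v with toℕ u <? toℕ v | toℕ v <? toℕ u | F u v
  ... | yes u<v | yes v<u | _ = contradiction u<v (<-asym v<u)
  ... | yes _   | no _    | b = ≤-reflexive (+-identityʳ (𝟙 b))
  ... | no _    | yes _   | _ = ≤-refl
  ... | no _    | no _    | _ = z≤n

increasesRoman : {n : ℕ} (G : Graph n) (F : Fin n → Fin n → Bool) {γR : ℕ} → IsRomanNum G γR →
                 (∀ f → RomanDF (removeEdges G F) f → γR < weight f) → IncreasesRoman G F
increasesRoman G F rom heavier _ _ rom′ ((f , rdf , refl) , _) =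
  subst (_< weight f) (IsMin-unique rom rom′) (heavier f rdf)

increasesDom⇒increasesRoman : {n : ℕ} (G : Graph n) (F : Fin n → Fin n → Bool) {γ : ℕ} →
                              IsDomNum G γ → IsRomanNum G (suc γ) → suc γ < n →
                              IncreasesDom G F → IncreasesRoman G F
increasesDom⇒increasesRoman G F {γ} dom rom γR<n incDom = increasesRoman G F rom heavier
  where
  heavier : ∀ f → RomanDF (removeEdges G F) f → suc γ < weight f
  heavier f rdf = ≰⇒> λ w≤γR → lighter w≤γR (domNum-exists (removeEdges G F))
    where
    lighter : weight f ≤ suc γ → ∃ (IsDomNum (removeEdges G F)) → ⊥
    lighter w≤γR (γ′ , γ′-isDom) with romanDF⇒dominating< f {removeEdges G F} rdf (≤-<-trans w≤γR γR<n)
    ... | S , S-dom , ∣S∣<w =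
      <⇒≱ (incDom γ γ′ dom γ′-isDom)
          (≤-trans (proj₂ γ′-isDom _ (S , S-dom , refl)) (s≤s⁻¹ (≤-trans ∣S∣<w w≤γR)))

isMaxDeg : {n : ℕ} → Graph n → Fin n → Bool
isMaxDeg G u = ⌊ deg G u ℕ.≟ maxDeg G ⌋

-- Some neighbour of u, or u itself if u is isolated.
neighbour : {n : ℕ} → Graph n → Fin n → Fin n
neighbour G u with any? (λ w → adj G u w ≟ᵇ true)
... | yes (w , _) = w
... | no _        = u

adj-neighbour : {n : ℕ} (G : Graph n) {u w : Fin n} → adj G u w ≡ true → adj G u (neighbour G u) ≡ true
adj-neighbour G {u} {w} uw with any? (λ w → adj G u w ≟ᵇ true)
... | yes (_ , uw′) = uw′
... | no ∄         = contradiction (w , uw) ∄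

maxDegreeEdges : {n : ℕ} → Graph n → Fin n → Fin n → Bool
maxDegreeEdges G u w = isMaxDeg G u ∧ ⌊ w ≟ neighbour G u ⌋ ∧ adj G u w

∧-true : {a b : Bool} → a ∧ b ≡ true → a ≡ true × b ≡ true
∧-true {true} {true} _ = refl , refl
∧-true {true} {false} ()
∧-true {false} ()

maxDegreeEdges⊆E : {n : ℕ} (G : Graph n) → EdgeSubset G (maxDegreeEdges G)
maxDegreeEdges⊆E G u w uw∈M = proj₂ (∧-true {⌊ w ≟ neighbour G u ⌋} (proj₂ (∧-true {isMaxDeg G u} uw∈M)))

edgeCount-maxDegreeEdges : {n : ℕ} (G : Graph n) → edgeCount (maxDegreeEdges G) ≤ nΔ G
edgeCount-maxDegreeEdges {n} G =
  ≤-trans (edgeCount≤∑count (maxDegreeEdges G))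
          (subst (∑[ u < n ] count (maxDegreeEdges G u) ≤_) (sym (count≡∑ (isMaxDeg G)))
                 (∑-mono-≤ atMostOne))
  where
  atMostOne : ∀ u → count (maxDegreeEdges G u) ≤ 𝟙 (isMaxDeg G u)
  atMostOne u with isMaxDeg G u
  ... | true  = ≤-trans (count-mono {p = λ w → ⌊ w ≟ neighbour G u ⌋ ∧ adj G u w} λ _ → proj₁ ∘ ∧-true)
                        (≤-reflexive (count-singleton (neighbour G u)))
  ... | false = ≤-reflexive (count-false n)

deg-removeMaxDegreeEdges< : {n : ℕ} (G : Graph n) {v : Fin n} → deg G v ≡ maxDeg G → 1 ≤ deg G v →
                            deg (removeEdges G (maxDegreeEdges G)) v < deg G v
deg-removeMaxDegreeEdges< G {v} v-max 1≤deg with count-witness (adj G v) 1≤deg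
... | _ , vw = deg-removeEdges< G (maxDegreeEdges G) vn∈M (adj-neighbour G vw)
  where
  vn∈M : maxDegreeEdges G v (neighbour G v) ≡ true
  vn∈M = cong₂ _∧_ (isYes-true (deg G v ℕ.≟ maxDeg G) v-max)
                   (cong₂ _∧_ (isYes-true (neighbour G v ≟ neighbour G v) refl) (adj-neighbour G vw))
    where
    isYes-true : {A : Set} (a? : Dec A) → A → ⌊ a? ⌋ ≡ true
    isYes-true a? a = trans (isYes≗does a?) (dec-true a? a)

maxDegreeEdges-increasesRoman : {n : ℕ} (G : Graph n) {γ : ℕ} → IsDomNum G γ → IsRomanNum G (suc γ) →
                                suc γ < n → IncreasesRoman G (maxDegreeEdges G)
maxDegreeEdges-increasesRoman {n} G {γ} dom rom γR<n = increasesRoman G M rom heavier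
  where
  M : Fin n → Fin n → Bool
  M = maxDegreeEdges G
  H : Graph n
  H = removeEdges G M
  γ+deg≤n : ∀ w → γ + deg G w ≤ n
  γ+deg≤n w = subst (_≤ n) (+-comm (deg G w) γ) (deg+γ≤n G dom w)
  noCentre : ¬ ∃ λ v → n ≤ γ + deg H v
  noCentre (v , n≤γ+degH) = <⇒≱ (+-monoʳ-< γ (deg-removeMaxDegreeEdges< G v-max 1≤degG))
                                 (≤-trans (γ+deg≤n v) n≤γ+degH)
    where
    degG≤degH : ∀ w → deg G w ≤ deg H v
    degG≤degH w = +-cancelˡ-≤ γ _ _ (≤-trans (γ+deg≤n w) n≤γ+degH)
    v-max : deg G v ≡ maxDeg G
    v-max = ≤-antisym (deg≤maxDeg G v)
                      (maxDeg-lub G λ w → ≤-trans (degG≤degH w) (deg-removeEdges≤ G M v))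
    1≤degG : 1 ≤ deg G v
    1≤degG = ≤-trans (+-cancelˡ-≤ γ 1 _ (subst (_≤ γ + deg H v) (+-comm 1 γ)
                                               (≤-trans (<⇒≤ γR<n) n≤γ+degH)))
                     (deg-removeEdges≤ G M v)
  heavier : ∀ f → RomanDF H f → suc γ < weight f
  heavier f rdf = ≰⇒> λ w≤γR → noCentre (light⇒n≤γ+deg f {H} rdf γ≤V₁₂ w≤γR γR<n)
    where
    γ≤V₁₂ : γ ≤ count (V₁₂ f)
    γ≤V₁₂ = proj₂ dom _ ( toSubset (V₁₂ f)
                        , dominating-removeEdges G M (V₁₂-dominating f {H} rdf)
                        , ∣toSubset∣ (V₁₂ f) )

theorem7 : (n : ℕ) → 3 ≤ n → (G : Graph n) → Connected G →
    (γ γR b bR : ℕ) → IsDomNum G γ → IsRomanNum G γR → γR ≡ γ + 1 →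
    IsBondage G b → IsRomanBondage G bR →
    bR ≤ b ⊓ nΔ G
theorem7 n 3≤n G conn γ _ b bR dom rom refl ((F , F⊆E , incDom , refl) , _) (_ , bR-min) =
  ⊓-glb (bR-min _ (F , F⊆E , F-increasesRoman , refl))
        (≤-trans (bR-min _ (maxDegreeEdges G , maxDegreeEdges⊆E G , M-increasesRoman , refl))
                 (edgeCount-maxDegreeEdges G))
  where
  rom′ : IsRomanNum G (suc γ)
  rom′ = subst (IsRomanNum G) (+-comm γ 1) rom
  γR<n : suc γ < n
  γR<n = romanNum<order 3≤n G conn {suc γ} rom′
  F-increasesRoman : IncreasesRoman G F
  F-increasesRoman = increasesDom⇒increasesRoman G F dom rom′ γR<n incDom
  M-increasesRoman : IncreasesRoman G (maxDegreeEdges G)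
  M-increasesRoman = maxDegreeEdges-increasesRoman G dom rom′ γR<n
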